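{- Let $P$ be a poset which is not a block, and let $P=Q_1<\dots<Q_t$ be the block decomposition of $P$. Then, (1) $\operatorname{ch}(P)=\dim_2(P-Q_t)+\operatorname{ch}(Q_t)$, (2) $\dim_2(P)=\dim_2(Q_1)+\dots+\dim_2(Q_t)$, (3) $\operatorname{cw}(P)=\dim_2(P-Q_t)+\operatorname{cw}(Q_t)$, (4) $\operatorname{iir}(P)=\operatorname{iir}(Q_1)+\dots+\operatorname{iir}(Q_t)$.
   Context: All posets are finite with non-empty ground sets. An inclusion representation of $P$ is a family $\mathcal{S}=\{S_x:x\in P\}$ with $x\le y$ iff $S_x\subseteq S_y$; $\operatorname{ch}(P)$ is the least $h$ admitting one with all $|S_x|\le h$; $\dim_2(P)$ the least $|\bigcup\mathcal{S}|$; $\operatorname{cw}(P)$ the least $|\bigcup\mathcal{S}|$ subject to all $|S_x|\le\operatorname{ch}(P)$. $\mathcal{S}$ is a reduction of $\mathcal{S}'$ if $|\bigcup\mathcal{S}|\le|\bigcup\mathcal{S}'|$ and $|S_x|\le|S'_x|$ for all $x$; a strict reduction if additionally $\mathcal{S}'$ is not a reduction of $\mathcal{S}$; irreducible if it has no strict reduction; $\operatorname{iir}(P)$ is the maximum ground-set size of an irreducible inclusion representation of $P$. The vertical sum $Q_1<\dots<Q_t$ has $x\le y$ iff $x,y\in Q_i$ with $x\le y$ in $Q_i$, or $x\in Q_i,y\in Q_j$, $i<j$. A block is a chain or a poset not a vertical sum of two non-empty posets; for a non-block $P$, the block decomposition is $P=Q_1<\dots<Q_t$ with least $t\ge2$ and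 each $Q_i$ a block. -}

module Defs where

open import Data.Nat.Base using (ℕ; zero; suc; _+_; _≤_; _<_)
open import Data.Fin.Base as Fin using (Fin; fromℕ)
import Data.Fin.Properties as FinP
open import Data.Fin.Subset
  using (Subset; _∈_; _⊆_; _∪_; ∁; ∣_∣; ⊤)
  renaming (⊥ to ∅)
open import Data.Bool.Base using (Bool; true; false; if_then_else_; _∧_)
open import Data.List.Base using (List; foldr; allFin)
open import Data.Vec.Base using (lookup; tabulate)
open import Data.Vec.Functional as VF using ()
open import Data.Product.Base using (Σ; Σ-syntax; ∃; ∃-syntax; _×_; _,_)
open import Data.Sum.Base using (_⊎_)
open import Relation.Nullary using (¬_)
open import Relation.Nullary.Decidable using (⌊_⌋)
open import Relation.Binary.PropositionalEquality using (_≡_)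
open import Relation.Binary.Structures using (IsPartialOrder)

record FinPoset : Set₁ where
  field
    size           : ℕ
    nonEmpty       : 0 < size
    _≼_            : Fin size → Fin size → Set
    isPartialOrder : IsPartialOrder _≡_ _≼_

-- All notions below are defined for the subposet of P induced on a
-- subset U of its ground set (U = ⊤ gives P itself).  Sets of an
-- inclusion representation live in Subset m for some m (any finite
-- family of finite sets can be relabelled into some Fin m).

module _ (P : FinPoset) where
  open FinPoset P

  private
    n = size

  UnionOver : ∀ {m} → Subset n → (Fin n → Subset m) → Subset m
  UnionOver U S =
    foldr (λ x acc → if lookup U x then S x ∪ acc else acc) ∅ (allFin n)

  GroundSize : ∀ {m} → Subset n → (Fin n → Subset m) → ℕ
  GroundSize U S = ∣ UnionOver U S ∣

  IsInclRep : ∀ {m} → Subset n → (Fin n → Subset m) → Set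
  IsInclRep U S = ∀ x y → x ∈ U → y ∈ U →
    (x ≼ y → S x ⊆ S y) × (S x ⊆ S y → x ≼ y)

  HeightAtMost : ∀ {m} → Subset n → (Fin n → Subset m) → ℕ → Set
  HeightAtMost U S h = ∀ x → x ∈ U → ∣ S x ∣ ≤ h

  IsCh : Subset n → ℕ → Set
  IsCh U h =
    (Σ[ m ∈ ℕ ] Σ[ S ∈ (Fin n → Subset m) ] IsInclRep U S × HeightAtMost U S h)
    × (∀ m (S : Fin n → Subset m) h' → IsInclRep U S → HeightAtMost U S h' → h ≤ h')

  IsDim2 : Subset n → ℕ → Set
  IsDim2 U d =
    (Σ[ m ∈ ℕ ] Σ[ S ∈ (Fin n → Subset m) ] IsInclRep U S × GroundSize U S ≡ d)
    × (∀ m (S : Fin n → Subset m) → IsInclRep U S → d ≤ GroundSize U S)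

  IsCw : Subset n → ℕ → Set
  IsCw U w = Σ[ h ∈ ℕ ] IsCh U h ×
    ((Σ[ m ∈ ℕ ] Σ[ S ∈ (Fin n → Subset m) ]
        IsInclRep U S × HeightAtMost U S h × GroundSize U S ≡ w)
     × (∀ m (S : Fin n → Subset m) → IsInclRep U S → HeightAtMost U S h →
          w ≤ GroundSize U S))

  IsReduction : ∀ {m m'} → Subset n → (Fin n → Subset m) → (Fin n → Subset m') → Set
  IsReduction U S S' =
    GroundSize U S ≤ GroundSize U S' × (∀ x → x ∈ U → ∣ S x ∣ ≤ ∣ S' x ∣)

  IsStrictReduction : ∀ {m m'} → Subset n → (Fin n → Subset m) → (Fin n → Subset m') → Set
  IsStrictReduction U S S' = IsReduction U S S' × ¬ IsReduction U S' S

  IsIrreducible : ∀ {m} → Subset n → (Fin n → Subset m) → Set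
  IsIrreducible U S = IsInclRep U S ×
    (∀ m' (S' : Fin n → Subset m') → IsInclRep U S' → ¬ IsStrictReduction U S' S)

  IsIir : Subset n → ℕ → Set
  IsIir U k =
    (Σ[ m ∈ ℕ ] Σ[ S ∈ (Fin n → Subset m) ] IsIrreducible U S × GroundSize U S ≡ k)
    × (∀ m (S : Fin n → Subset m) → IsIrreducible U S → GroundSize U S ≤ k)

  IsChain : Subset n → Set
  IsChain U = ∀ x y → x ∈ U → y ∈ U → x ≼ y ⊎ y ≼ x

  -- f assigns to each element of U its summand index: P[U] = Q_0 < … < Q_{t-1}
  -- with Q_i = P[{x ∈ U | f x = i}], each Q_i non-empty.
  IsVerticalDecomp : Subset n → (t : ℕ) → (Fin n → Fin t) → Set
  IsVerticalDecomp U t f =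
    (∀ i → ∃[ x ] (x ∈ U × f x ≡ i))
    × (∀ x y → x ∈ U → y ∈ U → f x Fin.< f y → x ≼ y)

  Level : ∀ {t} → Subset n → (Fin n → Fin t) → Fin t → Subset n
  Level U f i = tabulate (λ x → lookup U x ∧ ⌊ f x FinP.≟ i ⌋)

  IsVerticalSumOfTwo : Subset n → Set
  IsVerticalSumOfTwo U = Σ[ f ∈ (Fin n → Fin 2) ] IsVerticalDecomp U 2 f

  IsBlock : Subset n → Set
  IsBlock U = IsChain U ⊎ ¬ IsVerticalSumOfTwo U

  IsDecompIntoBlocks : (t : ℕ) → (Fin n → Fin t) → Set
  IsDecompIntoBlocks t f =
    2 ≤ t × IsVerticalDecomp ⊤ t f × (∀ i → IsBlock (Level ⊤ f i))

  IsBlockDecomposition : (t : ℕ) → (Fin n → Fin t) → Set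
  IsBlockDecomposition t f =
    IsDecompIntoBlocks t f
    × (∀ t' (g : Fin n → Fin t') → IsDecompIntoBlocks t' g → t ≤ t')

{-# OPTIONS --safe #-}
-- Cut P at the junction of two consecutive blocks, P = L < V.  Representations S₁ of L and S₂
-- of V stack to one of P on the disjoint union of their ground sets: x ∈ L gets S₁ x and y ∈ V
-- gets (⋃ S₁) ⊎ S₂ y.  Conversely a representation S of P restricts to L, and y ↦ S y ∖ ⋃_{x ∈ L} S x
-- represents V; the ground set splits accordingly and every S y contains ⋃_{x ∈ L} S x.
-- Stacking is faithful unless L has a greatest and V a least element (they could get the same
-- set).  Minimality of the block decomposition excludes this: a block with a greatest or least
-- element is a chain, and two adjacent chains would merge into one block.  The two constructions
-- transfer ground sizes, heights and (ir)reducibility between P and the pair (L, V), giving each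
-- formula for a single cut.  (1) and (3) use the cut below the top block; (2) and (4) follow by
-- adding the blocks one at a time.
module Submission where

open import Defs
open import Data.Nat.Base using (ℕ; zero; suc; _+_)
open import Data.Fin.Base using (Fin; fromℕ)
open import Data.Fin.Subset using (⊤; ∁)
open import Data.Vec.Base using (sum; tabulate)
open import Data.Product.Base using (_×_; _,_)
open import Relation.Nullary using (¬_)
open import Relation.Binary.PropositionalEquality using (_≡_)

module SubsetLemmas where

  open import Data.Nat.Properties using (+-suc)
  open import Data.Bool.Base using (Bool; true; false)
  open import Data.Fin.Base using (zero; suc; _↑ˡ_; _↑ʳ_; splitAt)
  open import Data.Fin.Properties using (splitAt⁻¹-↑ˡ; splitAt⁻¹-↑ʳ)
  open import Data.Fin.Subset using (Subset; _∈_; _∉_; _⊆_; _─_; ∣_∣)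
  open import Data.Fin.Subset.Properties using (drop-∷-⊆)
  open import Data.Vec.Base using ([]; _∷_; here; there; _++_)
  open import Data.Vec.Properties using (lookup∘tabulate; []=⇒lookup; lookup⇒[]=)
  open import Data.Product.Base using (∃)
  open import Data.Sum.Base using (_⊎_; inj₁; inj₂)
  open import Relation.Binary.PropositionalEquality using (refl; sym; trans; cong)

  private variable m n : ℕ

  ∈-tabulate⁻ : ∀ {p : Fin n → Bool} {x} → x ∈ tabulate p → p x ≡ true
  ∈-tabulate⁻ {p = p} {x} x∈ = trans (sym (lookup∘tabulate p x)) ([]=⇒lookup x∈)

  ∈-tabulate⁺ : ∀ {p : Fin n → Bool} {x} → p x ≡ true → x ∈ tabulate p
  ∈-tabulate⁺ {p = p} {x} px = lookup⇒[]= x _ (trans (lookup∘tabulate p x) px)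

  x∈p─q⇒x∉q : ∀ (p q : Subset n) {x} → x ∈ p ─ q → x ∉ q
  x∈p─q⇒x∉q (_ ∷ p) (_ ∷ q) (there x∈p─q) (there x∈q) = x∈p─q⇒x∉q p q x∈p─q x∈q

  ∣q∣+∣p─q∣≡∣p∣ : ∀ {p q : Subset n} → q ⊆ p → ∣ q ∣ + ∣ p ─ q ∣ ≡ ∣ p ∣
  ∣q∣+∣p─q∣≡∣p∣ {p = []}        {[]}        _   = refl
  ∣q∣+∣p─q∣≡∣p∣ {p = true ∷ p}  {true ∷ q}  q⊆p = cong suc (∣q∣+∣p─q∣≡∣p∣ (drop-∷-⊆ q⊆p))
  ∣q∣+∣p─q∣≡∣p∣ {p = true ∷ p}  {false ∷ q} q⊆p = trans (+-suc ∣ q ∣ _) (cong suc (∣q∣+∣p─q∣≡∣p∣ (drop-∷-⊆ q⊆p)))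
  ∣q∣+∣p─q∣≡∣p∣ {p = false ∷ p} {false ∷ q} q⊆p = ∣q∣+∣p─q∣≡∣p∣ (drop-∷-⊆ q⊆p)
  ∣q∣+∣p─q∣≡∣p∣ {p = false ∷ p} {true ∷ q}  q⊆p with q⊆p here
  ... | ()

  ∣p++q∣≡∣p∣+∣q∣ : ∀ (p : Subset m) (q : Subset n) → ∣ p ++ q ∣ ≡ ∣ p ∣ + ∣ q ∣
  ∣p++q∣≡∣p∣+∣q∣ []          q = refl
  ∣p++q∣≡∣p∣+∣q∣ (true ∷ p)  q = cong suc (∣p++q∣≡∣p∣+∣q∣ p q)
  ∣p++q∣≡∣p∣+∣q∣ (false ∷ p) q = ∣p++q∣≡∣p∣+∣q∣ p q

  ∈-++⁺ˡ : ∀ {p : Subset m} {q : Subset n} {x} → x ∈ p → x ↑ˡ n ∈ p ++ q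
  ∈-++⁺ˡ here        = here
  ∈-++⁺ˡ (there x∈p) = there (∈-++⁺ˡ x∈p)

  ∈-++⁻ˡ : ∀ (p : Subset m) {q : Subset n} {x} → x ↑ˡ n ∈ p ++ q → x ∈ p
  ∈-++⁻ˡ (true ∷ p) {x = zero}  here      = here
  ∈-++⁻ˡ (_ ∷ p)    {x = suc x} (there h) = there (∈-++⁻ˡ p h)

  ∈-++⁺ʳ : ∀ (p : Subset m) {q : Subset n} {x} → x ∈ q → m ↑ʳ x ∈ p ++ q
  ∈-++⁺ʳ []      x∈q = x∈q
  ∈-++⁺ʳ (_ ∷ p) x∈q = there (∈-++⁺ʳ p x∈q)

  ∈-++⁻ʳ : ∀ (p : Subset m) {q : Subset n} {x} → m ↑ʳ x ∈ p ++ q → x ∈ q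
  ∈-++⁻ʳ []      h         = h
  ∈-++⁻ʳ (_ ∷ p) (there h) = ∈-++⁻ʳ p h

  ↑ˡ-or-↑ʳ : ∀ m {n} (i : Fin (m + n)) → (∃ λ j → j ↑ˡ n ≡ i) ⊎ (∃ λ j → m ↑ʳ j ≡ i)
  ↑ˡ-or-↑ʳ m i with splitAt m i in eq
  ... | inj₁ j = inj₁ (j , splitAt⁻¹-↑ˡ eq)
  ... | inj₂ j = inj₂ (j , splitAt⁻¹-↑ʳ eq)

  ++-⊆⁺ : ∀ {p p′ : Subset m} {q q′ : Subset n} → p ⊆ p′ → q ⊆ q′ → p ++ q ⊆ p′ ++ q′
  ++-⊆⁺ {m} {p = p} {p′} {q} {q′} p⊆p′ q⊆q′ {i} i∈ with ↑ˡ-or-↑ʳ m i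
  ... | inj₁ (j , refl) = ∈-++⁺ˡ (p⊆p′ (∈-++⁻ˡ p i∈))
  ... | inj₂ (j , refl) = ∈-++⁺ʳ p′ (q⊆q′ (∈-++⁻ʳ p i∈))

  ++-⊆⁻ˡ : ∀ {p p′ : Subset m} {q q′ : Subset n} → p ++ q ⊆ p′ ++ q′ → p ⊆ p′
  ++-⊆⁻ˡ {p′ = p′} ⊆′ x∈p = ∈-++⁻ˡ p′ (⊆′ (∈-++⁺ˡ x∈p))

  ++-⊆⁻ʳ : ∀ {p p′ : Subset m} {q q′ : Subset n} → p ++ q ⊆ p′ ++ q′ → q ⊆ q′
  ++-⊆⁻ʳ {p = p} {p′} ⊆′ x∈q = ∈-++⁻ʳ p′ (⊆′ (∈-++⁺ʳ p x∈q))

module UnionLemmas (P : FinPoset) where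

  open FinPoset P using (size)
  open import Data.Bool.Base using (true; false; if_then_else_)
  open import Data.Fin.Subset using (Subset; _∈_; _⊆_; _∪_; ⊥)
  open import Data.Fin.Subset.Properties using (∉⊥; x∈p∪q⁻; p⊆p∪q; q⊆p∪q)
  open import Data.List.Base using ([]; _∷_; foldr; allFin)
  open import Data.List.Relation.Unary.Any using (here; there)
  open import Data.List.Membership.Propositional using () renaming (_∈_ to _∈ₗ_)
  open import Data.List.Membership.Propositional.Properties using (∈-allFin)
  open import Data.Vec.Base using (lookup)
  open import Data.Vec.Properties using (lookup⇒[]=; []=⇒lookup)
  open import Data.Product.Base using (∃)
  open import Data.Sum.Base using (inj₁; inj₂)
  open import Data.Empty using (⊥-elim)
  open import Relation.Binary.PropositionalEquality using (refl)

  module _ {m} (U : Subset size) (S : Fin size → Subset m) where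

    private
      addIfIn : Fin size → Subset m → Subset m
      addIfIn x acc = if lookup U x then S x ∪ acc else acc

      ∈-foldr⁻ : ∀ xs {i} → i ∈ foldr addIfIn ⊥ xs → ∃ λ x → x ∈ U × i ∈ S x
      ∈-foldr⁻ []       i∈ = ⊥-elim (∉⊥ i∈)
      ∈-foldr⁻ (x ∷ xs) i∈ with lookup U x in x∈U
      ... | false = ∈-foldr⁻ xs i∈
      ... | true with x∈p∪q⁻ (S x) _ i∈
      ...   | inj₁ i∈Sx = x , lookup⇒[]= x U x∈U , i∈Sx
      ...   | inj₂ i∈xs = ∈-foldr⁻ xs i∈xs

      ⊆-foldr : ∀ {xs x} → x ∈ₗ xs → x ∈ U → S x ⊆ foldr addIfIn ⊥ xs
      ⊆-foldr {y ∷ _}  (here refl) x∈U rewrite []=⇒lookup x∈U = p⊆p∪q _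
      ⊆-foldr {y ∷ xs} (there x∈xs) x∈U i∈ with lookup U y
      ... | true  = q⊆p∪q (S y) _ (⊆-foldr x∈xs x∈U i∈)
      ... | false = ⊆-foldr x∈xs x∈U i∈

    ∈-UnionOver⁻ : ∀ {i} → i ∈ UnionOver P U S → ∃ λ x → x ∈ U × i ∈ S x
    ∈-UnionOver⁻ = ∈-foldr⁻ (allFin size)

    ⊆-UnionOver : ∀ {x} → x ∈ U → S x ⊆ UnionOver P U S
    ⊆-UnionOver {x} = ⊆-foldr (∈-allFin x)

    UnionOver-least : ∀ {B} → (∀ {x} → x ∈ U → S x ⊆ B) → UnionOver P U S ⊆ B
    UnionOver-least S⊆B i∈ with ∈-UnionOver⁻ i∈
    ... | x , x∈U , i∈Sx = S⊆B x∈U i∈Sx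

module Representations (P : FinPoset) where

  open FinPoset P using (size)
  open UnionLemmas P
  open import Data.Nat.Base using (_≤_; z≤n)
  open import Data.Nat.Properties using (≤-refl; ≤-trans; ≤-reflexive; ≤-antisym; n≤0⇒n≡0; _≤?_)
  open import Data.Fin.Properties using (all?)
  open import Data.Fin.Subset using (Subset; _∈_; _⊆_; ∣_∣; ⊥; Empty)
  open import Data.Fin.Subset.Properties using (_∈?_; p⊆q⇒∣p∣≤∣q∣; ∣⊥∣≡0)
  open import Data.Vec.Base using ([])
  open import Relation.Nullary using (Dec; contradiction)
  open import Relation.Nullary.Decidable using (_×-dec_; _→-dec_; decidable-stable)
  open import Relation.Binary.PropositionalEquality using (refl; sym; subst)

  private variable
    m m′ m″ : ℕ
    U U′ : Subset size
    a b : ℕ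

  IsInclRep-⊆ : ∀ {S : Fin size → Subset m} → U′ ⊆ U → IsInclRep P U S → IsInclRep P U′ S
  IsInclRep-⊆ U′⊆U rep x y x∈U′ y∈U′ = rep x y (U′⊆U x∈U′) (U′⊆U y∈U′)

  IsReduction-refl : ∀ {S : Fin size → Subset m} → IsReduction P U S S
  IsReduction-refl = ≤-refl , λ _ _ → ≤-refl

  module _ {S : Fin size → Subset m} {S′ : Fin size → Subset m′} where

    IsReduction-trans : ∀ {S″ : Fin size → Subset m″} →
                        IsReduction P U S S′ → IsReduction P U S′ S″ → IsReduction P U S S″
    IsReduction-trans (g , h) (g′ , h′) = ≤-trans g g′ , λ x x∈U → ≤-trans (h x x∈U) (h′ x x∈U)

    sameSizes⇒IsReduction : GroundSize P U S ≡ GroundSize P U S′ →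
                            (∀ x → x ∈ U → ∣ S x ∣ ≡ ∣ S′ x ∣) → IsReduction P U S S′
    sameSizes⇒IsReduction g h = ≤-reflexive g , λ x x∈U → ≤-reflexive (h x x∈U)

    isReduction? : Dec (IsReduction P U S S′)
    isReduction? {U = U} = GroundSize P U S ≤? GroundSize P U S′
                 ×-dec all? (λ x → (x ∈? U) →-dec (∣ S x ∣ ≤? ∣ S′ x ∣))

    IsIrreducible⇒reduction-reverses : IsIrreducible P U S → IsInclRep P U S′ →
                                       IsReduction P U S′ S → IsReduction P U S S′
    IsIrreducible⇒reduction-reverses (_ , irr) rep′ red =
      decidable-stable isReduction? (λ ¬back → irr _ S′ rep′ (red , ¬back))

  module _ (empty : Empty U) where

    GroundSize-empty : (S : Fin size → Subset m) → GroundSize P U S ≡ 0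
    GroundSize-empty {m} S = n≤0⇒n≡0 (subst (GroundSize P U S ≤_) (∣⊥∣≡0 m)
      (p⊆q⇒∣p∣≤∣q∣ {q = ⊥} (UnionOver-least U S λ x∈U → contradiction (_ , x∈U) empty)))

    private
      emptyRep : IsInclRep P U (λ _ → [])
      emptyRep x _ x∈U = contradiction (x , x∈U) empty

    IsDim2-empty : IsDim2 P U 0
    IsDim2-empty = (0 , _ , emptyRep , GroundSize-empty _) , λ _ _ _ → z≤n

    IsIir-empty : IsIir P U 0
    IsIir-empty = (0 , _ , (emptyRep , noStrictReduction) , GroundSize-empty _) ,
                  λ _ S _ → ≤-reflexive (GroundSize-empty S)
      where
      noStrictReduction : ∀ m′ (S′ : Fin size → Subset m′) → IsInclRep P U S′ →
                          ¬ IsStrictReduction P U S′ (λ _ → [])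
      noStrictReduction _ S′ _ (_ , ¬back) = ¬back
        (subst (_≤ GroundSize P U S′) (sym (GroundSize-empty _)) z≤n ,
         λ x x∈U → contradiction (x , x∈U) empty)

  IsDim2-unique : IsDim2 P U a → IsDim2 P U b → a ≡ b
  IsDim2-unique ((_ , S , rep , refl) , least) ((_ , S′ , rep′ , refl) , least′) =
    ≤-antisym (least _ S′ rep′) (least′ _ S rep)

  IsCh-unique : IsCh P U a → IsCh P U b → a ≡ b
  IsCh-unique ((_ , S , rep , ht) , least) ((_ , S′ , rep′ , ht′) , least′) =
    ≤-antisym (least _ S′ _ rep′ ht′) (least′ _ S _ rep ht)

  IsCw-unique : IsCw P U a → IsCw P U b → a ≡ b
  IsCw-unique (_ , ch , (_ , S , rep , ht , refl) , least) (_ , ch′ , (_ , S′ , rep′ , ht′ , refl) , least′)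
    with refl ← IsCh-unique ch ch′ = ≤-antisym (least _ S′ rep′ ht′) (least′ _ S rep ht)

  IsIir-unique : IsIir P U a → IsIir P U b → a ≡ b
  IsIir-unique ((_ , S , irr , refl) , greatest) ((_ , S′ , irr′ , refl) , greatest′) =
    ≤-antisym (greatest′ _ S irr) (greatest _ S′ irr′)

module VerticalSplits (P : FinPoset) where

  open FinPoset P
  open import Relation.Binary.Structures using (IsPartialOrder)
  open IsPartialOrder isPartialOrder using (antisym)
  open SubsetLemmas
  open UnionLemmas P
  open Representations P
  open import Data.Nat.Base using (_≤_; _∸_)
  open import Data.Nat.Properties
    using (≤-refl; ≤-trans; ≤-reflexive; ≤-antisym; ≤-total; +-comm; +-identityʳ; +-mono-≤; +-monoˡ-≤;
           +-monoʳ-≤; +-cancelˡ-≤; +-cancelʳ-≤; m≤m+n; m+[n∸m]≡n; m+n∸m≡n; m+n≤o⇒m≤o∸n; module ≤-Reasoning)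
  open import Data.Bool.Base using (if_then_else_)
  open import Data.Fin.Subset using (Subset; _∈_; _∉_; _⊆_; _─_; ∣_∣; ⊥; Nonempty)
  open import Data.Fin.Subset.Properties
    using (_∈?_; ⊆-refl; ⊆-trans; ⊆-antisym; ⊥⊆; ∣⊥∣≡0; p⊆q⇒∣p∣≤∣q∣; p─q⊆p; x∈p∧x∉q⇒x∈p─q)
  open import Data.Vec.Base using (_++_)
  open import Data.Product.Base using (proj₁; proj₂)
  open import Data.Sum.Base using (_⊎_; inj₁; inj₂)
  open import Data.Empty using (⊥-elim) renaming (⊥ to False)
  open import Function.Base using (case_of_)
  open import Relation.Nullary using (yes; no; does; contradiction)
  open import Relation.Binary.PropositionalEquality
    using (refl; sym; trans; cong; cong₂; subst; subst₂; module ≡-Reasoning)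

  IsGreatest : Subset size → Fin size → Set
  IsGreatest U x = x ∈ U × (∀ z → z ∈ U → z ≼ x)

  IsLeast : Subset size → Fin size → Set
  IsLeast U x = x ∈ U × (∀ z → z ∈ U → x ≼ z)

  record IsVerticalSplit (W L V : Subset size) : Set where
    field
      disjoint   : ∀ {x} → x ∈ L → x ∉ V
      cover      : ∀ {x} → x ∈ W → x ∈ L ⊎ x ∈ V
      L⊆W        : L ⊆ W
      V⊆W        : V ⊆ W
      below      : ∀ {x y} → x ∈ L → y ∈ V → x ≼ y
      noJunction : ∀ {x y} → IsGreatest L x → IsLeast V y → False

  private variable
    m m₁ m₂ : ℕ
    a b h : ℕ
    x : Fin size

  module _ {W L V : Subset size} (split : IsVerticalSplit W L V) where

    open IsVerticalSplit split

    lowerPart : (Fin size → Subset m) → Subset m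
    lowerPart S = UnionOver P L S

    upperPart : (Fin size → Subset m) → Fin size → Subset m
    upperPart S x = S x ─ lowerPart S

    upperPart-ground : (S : Fin size → Subset m) →
                       GroundSize P W S ≡ GroundSize P L S + GroundSize P V (upperPart S)
    upperPart-ground {m} S = begin
      ∣ UnionOver P W S ∣                  ≡⟨ sym (∣q∣+∣p─q∣≡∣p∣ lower⊆union) ⟩
      ∣ A ∣ + ∣ UnionOver P W S ─ A ∣      ≡⟨ cong (λ B → ∣ A ∣ + ∣ B ∣) (⊆-antisym ⊆-upper ⊇-upper) ⟨
      ∣ A ∣ + GroundSize P V (upperPart S) ∎
      where
      open ≡-Reasoning
      A : Subset m
      A = lowerPart S
      lower⊆union : A ⊆ UnionOver P W S
      lower⊆union = UnionOver-least L S (λ x∈L → ⊆-UnionOver W S (L⊆W x∈L))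
      ⊆-upper : UnionOver P V (upperPart S) ⊆ UnionOver P W S ─ A
      ⊆-upper = UnionOver-least V (upperPart S) λ x∈V i∈ →
        x∈p∧x∉q⇒x∈p─q (⊆-UnionOver W S (V⊆W x∈V) (p─q⊆p _ _ i∈)) (x∈p─q⇒x∉q _ _ i∈)
      ⊇-upper : UnionOver P W S ─ A ⊆ UnionOver P V (upperPart S)
      ⊇-upper i∈ with ∈-UnionOver⁻ W S (p─q⊆p _ _ i∈)
      ... | x , x∈W , i∈Sx with cover x∈W
      ...   | inj₁ x∈L = contradiction (⊆-UnionOver L S x∈L i∈Sx) (x∈p─q⇒x∉q _ _ i∈)
      ...   | inj₂ x∈V = ⊆-UnionOver V (upperPart S) x∈V (x∈p∧x∉q⇒x∈p─q i∈Sx (x∈p─q⇒x∉q _ _ i∈))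

    module _ {S : Fin size → Subset m} (rep : IsInclRep P W S) where

      lowerPart⊆ : ∀ {y} → y ∈ V → lowerPart S ⊆ S y
      lowerPart⊆ y∈V = UnionOver-least L S λ x∈L →
        proj₁ (rep _ _ (L⊆W x∈L) (V⊆W y∈V)) (below x∈L y∈V)

      upperPart-rep : IsInclRep P V (upperPart S)
      upperPart-rep x y x∈V y∈V = mono , reflect
        where
        mono : x ≼ y → upperPart S x ⊆ upperPart S y
        mono x≼y i∈ = x∈p∧x∉q⇒x∈p─q (proj₁ (rep x y (V⊆W x∈V) (V⊆W y∈V)) x≼y (p─q⊆p _ _ i∈))
                                     (x∈p─q⇒x∉q _ _ i∈)
        reflect : upperPart S x ⊆ upperPart S y → x ≼ y
        reflect upper⊆ = proj₂ (rep x y (V⊆W x∈V) (V⊆W y∈V)) Sx⊆Sy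
          where
          Sx⊆Sy : S x ⊆ S y
          Sx⊆Sy {i} i∈ with i ∈? lowerPart S
          ... | yes i∈A = lowerPart⊆ y∈V i∈A
          ... | no  i∉A = p─q⊆p _ _ (upper⊆ (x∈p∧x∉q⇒x∈p─q i∈ i∉A))

      upperPart-size : ∀ {y} → y ∈ V → GroundSize P L S + ∣ upperPart S y ∣ ≡ ∣ S y ∣
      upperPart-size y∈V = ∣q∣+∣p─q∣≡∣p∣ (lowerPart⊆ y∈V)

      upperPart-height : HeightAtMost P W S h →
                         HeightAtMost P V (upperPart S) (h ∸ GroundSize P L S)
      upperPart-height ht y y∈V = m+n≤o⇒m≤o∸n _
        (≤-trans (≤-reflexive (trans (+-comm ∣ upperPart S y ∣ _) (upperPart-size y∈V))) (ht y (V⊆W y∈V)))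

      lowerGround≤height : Nonempty V → HeightAtMost P W S h → GroundSize P L S ≤ h
      lowerGround≤height (y , y∈V) ht = ≤-trans (p⊆q⇒∣p∣≤∣q∣ (lowerPart⊆ y∈V)) (ht y (V⊆W y∈V))

    stack : (Fin size → Subset m₁) → (Fin size → Subset m₂) → Fin size → Subset (m₁ + m₂)
    stack S₁ S₂ x = if does (x ∈? L) then S₁ x ++ ⊥ else lowerPart S₁ ++ S₂ x

    module _ (S₁ : Fin size → Subset m₁) (S₂ : Fin size → Subset m₂) where

      stack-onˡ : x ∈ L → stack S₁ S₂ x ≡ S₁ x ++ ⊥
      stack-onˡ {x} x∈L with x ∈? L
      ... | yes _   = refl
      ... | no  x∉L = contradiction x∈L x∉L

      stack-onʳ : x ∈ V → stack S₁ S₂ x ≡ lowerPart S₁ ++ S₂ x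
      stack-onʳ {x} x∈V with x ∈? L
      ... | yes x∈L = contradiction x∈V (disjoint x∈L)
      ... | no  _   = refl

      stack-sizeˡ : x ∈ L → ∣ stack S₁ S₂ x ∣ ≡ ∣ S₁ x ∣
      stack-sizeˡ {x} x∈L = begin
        ∣ stack S₁ S₂ x ∣    ≡⟨ cong ∣_∣ (stack-onˡ x∈L) ⟩
        ∣ S₁ x ++ ⊥ ∣        ≡⟨ ∣p++q∣≡∣p∣+∣q∣ (S₁ x) (⊥ {m₂}) ⟩
        ∣ S₁ x ∣ + ∣ ⊥ {m₂} ∣ ≡⟨ cong (∣ S₁ x ∣ +_) (∣⊥∣≡0 m₂) ⟩
        ∣ S₁ x ∣ + 0         ≡⟨ +-identityʳ _ ⟩
        ∣ S₁ x ∣             ∎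
        where open ≡-Reasoning

      stack-sizeʳ : x ∈ V → ∣ stack S₁ S₂ x ∣ ≡ GroundSize P L S₁ + ∣ S₂ x ∣
      stack-sizeʳ {x} x∈V = trans (cong ∣_∣ (stack-onʳ x∈V)) (∣p++q∣≡∣p∣+∣q∣ (lowerPart S₁) (S₂ x))

      stack-ground : GroundSize P W (stack S₁ S₂) ≡ GroundSize P L S₁ + GroundSize P V S₂
      stack-ground =
        trans (cong ∣_∣ (⊆-antisym ⊆-stack ⊇-stack)) (∣p++q∣≡∣p∣+∣q∣ (lowerPart S₁) (UnionOver P V S₂))
        where
        ⊆-stack : UnionOver P W (stack S₁ S₂) ⊆ lowerPart S₁ ++ UnionOver P V S₂
        ⊆-stack = UnionOver-least W (stack S₁ S₂) λ x∈W → case cover x∈W of λ where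
          (inj₁ x∈L) → subst (_⊆ _) (sym (stack-onˡ x∈L)) (++-⊆⁺ (⊆-UnionOver L S₁ x∈L) ⊥⊆)
          (inj₂ x∈V) → subst (_⊆ _) (sym (stack-onʳ x∈V)) (++-⊆⁺ ⊆-refl (⊆-UnionOver V S₂ x∈V))
        ⊇-stack : lowerPart S₁ ++ UnionOver P V S₂ ⊆ UnionOver P W (stack S₁ S₂)
        ⊇-stack {i} i∈ with ↑ˡ-or-↑ʳ m₁ i
        ... | inj₁ (j , refl) with ∈-UnionOver⁻ L S₁ (∈-++⁻ˡ _ i∈)
        ...   | x , x∈L , j∈S₁x = ⊆-UnionOver W (stack S₁ S₂) (L⊆W x∈L)
                                    (subst (_ ∈_) (sym (stack-onˡ x∈L)) (∈-++⁺ˡ j∈S₁x))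
        ⊇-stack i∈ | inj₂ (j , refl) with ∈-UnionOver⁻ V S₂ (∈-++⁻ʳ _ i∈)
        ...   | x , x∈V , j∈S₂x = ⊆-UnionOver W (stack S₁ S₂) (V⊆W x∈V)
                                    (subst (_ ∈_) (sym (stack-onʳ x∈V)) (∈-++⁺ʳ _ j∈S₂x))

      stack-rep : IsInclRep P L S₁ → IsInclRep P V S₂ → IsInclRep P W (stack S₁ S₂)
      stack-rep rep₁ rep₂ x y x∈W y∈W with cover x∈W | cover y∈W
      ... | inj₁ x∈L | inj₁ y∈L rewrite stack-onˡ x∈L | stack-onˡ y∈L =
        (λ x≼y → ++-⊆⁺ (proj₁ (rep₁ x y x∈L y∈L) x≼y) ⊆-refl) ,
        (λ ⊆′ → proj₂ (rep₁ x y x∈L y∈L) (++-⊆⁻ˡ ⊆′))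
      ... | inj₂ x∈V | inj₂ y∈V rewrite stack-onʳ x∈V | stack-onʳ y∈V =
        (λ x≼y → ++-⊆⁺ ⊆-refl (proj₁ (rep₂ x y x∈V y∈V) x≼y)) ,
        (λ ⊆′ → proj₂ (rep₂ x y x∈V y∈V) (++-⊆⁻ʳ {p = lowerPart S₁} {p′ = lowerPart S₁} ⊆′))
      ... | inj₁ x∈L | inj₂ y∈V rewrite stack-onˡ x∈L | stack-onʳ y∈V =
        (λ _ → ++-⊆⁺ (⊆-UnionOver L S₁ x∈L) ⊥⊆) , (λ _ → below x∈L y∈V)
      ... | inj₂ x∈V | inj₁ y∈L rewrite stack-onʳ x∈V | stack-onˡ y∈L =
        (λ x≼y → contradiction (subst (_∈ V) (antisym x≼y (below y∈L x∈V)) x∈V) (disjoint y∈L)) ,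
        (λ ⊆′ → ⊥-elim (noJunction (y∈L , greatest ⊆′) (x∈V , least ⊆′)))
        where
        greatest : lowerPart S₁ ++ S₂ x ⊆ S₁ y ++ ⊥ → ∀ z → z ∈ L → z ≼ y
        greatest ⊆′ z z∈L = proj₂ (rep₁ z y z∈L y∈L) (⊆-trans (⊆-UnionOver L S₁ z∈L) (++-⊆⁻ˡ ⊆′))
        least : lowerPart S₁ ++ S₂ x ⊆ S₁ y ++ ⊥ → ∀ z → z ∈ V → x ≼ z
        least ⊆′ z z∈V = proj₂ (rep₂ x z x∈V z∈V)
          (⊆-trans (++-⊆⁻ʳ {p = lowerPart S₁} {p′ = S₁ y} ⊆′) ⊥⊆)

      stack-height : GroundSize P L S₁ ≤ a → HeightAtMost P V S₂ b →
                     HeightAtMost P W (stack S₁ S₂) (a + b)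
      stack-height {a} {b} ground≤a ht₂ x x∈W with cover x∈W
      ... | inj₁ x∈L = begin
        ∣ stack S₁ S₂ x ∣    ≡⟨ stack-sizeˡ x∈L ⟩
        ∣ S₁ x ∣             ≤⟨ p⊆q⇒∣p∣≤∣q∣ (⊆-UnionOver L S₁ x∈L) ⟩
        GroundSize P L S₁    ≤⟨ ground≤a ⟩
        a                    ≤⟨ m≤m+n a b ⟩
        a + b                ∎
        where open ≤-Reasoning
      ... | inj₂ x∈V = begin
        ∣ stack S₁ S₂ x ∣              ≡⟨ stack-sizeʳ x∈V ⟩
        GroundSize P L S₁ + ∣ S₂ x ∣   ≤⟨ +-mono-≤ ground≤a (ht₂ x x∈V) ⟩
        a + b                          ∎
        where open ≤-Reasoning

    restack : (Fin size → Subset m) → Fin size → Subset (m + m)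
    restack S = stack S (upperPart S)

    module _ {S : Fin size → Subset m} (rep : IsInclRep P W S) where

      private
        restack-ground : GroundSize P W (restack S) ≡ GroundSize P W S
        restack-ground = trans (stack-ground S (upperPart S)) (sym (upperPart-ground S))

        restack-size : ∀ x → x ∈ W → ∣ restack S x ∣ ≡ ∣ S x ∣
        restack-size x x∈W with cover x∈W
        ... | inj₁ x∈L = stack-sizeˡ S (upperPart S) x∈L
        ... | inj₂ x∈V = trans (stack-sizeʳ S (upperPart S) x∈V) (upperPart-size rep x∈V)

      restack-reduces : IsReduction P W (restack S) S
      restack-reduces = sameSizes⇒IsReduction restack-ground restack-size

    module _ {m₁ m₁′ m₂ m₂′}
             {S₁ : Fin size → Subset m₁} {S₁′ : Fin size → Subset m₁′}
             {S₂ : Fin size → Subset m₂} {S₂′ : Fin size → Subset m₂′} where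

      stack-reduction⁺ : IsReduction P L S₁ S₁′ → IsReduction P V S₂ S₂′ →
                         IsReduction P W (stack S₁ S₂) (stack S₁′ S₂′)
      stack-reduction⁺ (g₁ , h₁) (g₂ , h₂) =
        subst₂ _≤_ (sym (stack-ground S₁ S₂)) (sym (stack-ground S₁′ S₂′)) (+-mono-≤ g₁ g₂) , sizes
        where
        sizes : ∀ x → x ∈ W → ∣ stack S₁ S₂ x ∣ ≤ ∣ stack S₁′ S₂′ x ∣
        sizes x x∈W with cover x∈W
        ... | inj₁ x∈L = subst₂ _≤_ (sym (stack-sizeˡ S₁ S₂ x∈L)) (sym (stack-sizeˡ S₁′ S₂′ x∈L)) (h₁ x x∈L)
        ... | inj₂ x∈V = subst₂ _≤_ (sym (stack-sizeʳ S₁ S₂ x∈V)) (sym (stack-sizeʳ S₁′ S₂′ x∈V))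
                                    (+-mono-≤ g₁ (h₂ x x∈V))

      stack-reduction⁻ˡ : IsReduction P W (stack S₁ S₂) (stack S₁′ S₂′) →
                          GroundSize P L S₁ ≤ GroundSize P L S₁′ → IsReduction P L S₁ S₁′
      stack-reduction⁻ˡ (_ , h) g₁ = g₁ , λ x x∈L →
        subst₂ _≤_ (stack-sizeˡ S₁ S₂ x∈L) (stack-sizeˡ S₁′ S₂′ x∈L) (h x (L⊆W x∈L))

      stack-reduction⁻ʳ : IsReduction P W (stack S₁ S₂) (stack S₁′ S₂′) →
                          GroundSize P L S₁′ ≤ GroundSize P L S₁ → IsReduction P V S₂ S₂′
      stack-reduction⁻ʳ (g , h) g₁′≤g₁ =
        cancel (subst₂ _≤_ (stack-ground S₁ S₂) (stack-ground S₁′ S₂′) g) ,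
        λ x x∈V → cancel (subst₂ _≤_ (stack-sizeʳ S₁ S₂ x∈V) (stack-sizeʳ S₁′ S₂′ x∈V) (h x (V⊆W x∈V)))
        where
        cancel : ∀ {u v} → GroundSize P L S₁ + u ≤ GroundSize P L S₁′ + v → u ≤ v
        cancel {u} le = +-cancelˡ-≤ _ u _ (≤-trans (+-monoˡ-≤ u g₁′≤g₁) le)

    module _ {S : Fin size → Subset m} (irr : IsIrreducible P W S) where

      private
        rep : IsInclRep P W S
        rep = proj₁ irr

      IsIrreducible-restrictˡ : IsIrreducible P L S
      IsIrreducible-restrictˡ = IsInclRep-⊆ L⊆W rep , λ _ S′ rep′ (red , ¬back) → ¬back (back S′ rep′ red)
        where
        back : ∀ {m′} (S′ : Fin size → Subset m′) → IsInclRep P L S′ →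
               IsReduction P L S′ S → IsReduction P L S S′
        back S′ rep′ red = stack-reduction⁻ˡ restack≤ (+-cancelʳ-≤ _ _ _
          (subst₂ _≤_ (stack-ground S (upperPart S)) (stack-ground S′ (upperPart S)) (proj₁ restack≤)))
          where
          T′≤S : IsReduction P W (stack S′ (upperPart S)) S
          T′≤S = IsReduction-trans (stack-reduction⁺ red IsReduction-refl) (restack-reduces rep)
          restack≤ : IsReduction P W (restack S) (stack S′ (upperPart S))
          restack≤ = IsReduction-trans (restack-reduces rep)
            (IsIrreducible⇒reduction-reverses irr (stack-rep S′ (upperPart S) rep′ (upperPart-rep rep)) T′≤S)

      IsIrreducible-upperPart : IsIrreducible P V (upperPart S)
      IsIrreducible-upperPart = upperPart-rep rep , λ _ R′ rep′ (red , ¬back) → ¬back (back R′ rep′ red)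
        where
        back : ∀ {m′} (R′ : Fin size → Subset m′) → IsInclRep P V R′ →
               IsReduction P V R′ (upperPart S) → IsReduction P V (upperPart S) R′
        back R′ rep′ red = stack-reduction⁻ʳ restack≤ ≤-refl
          where
          T′≤S : IsReduction P W (stack S R′) S
          T′≤S = IsReduction-trans (stack-reduction⁺ IsReduction-refl red) (restack-reduces rep)
          restack≤ : IsReduction P W (restack S) (stack S R′)
          restack≤ = IsReduction-trans (restack-reduces rep)
            (IsIrreducible⇒reduction-reverses irr (stack-rep S R′ (IsInclRep-⊆ L⊆W rep) rep′) T′≤S)

    IsIrreducible-stack : ∀ {S₁ : Fin size → Subset m₁} {S₂ : Fin size → Subset m₂} →
                          IsIrreducible P L S₁ → IsIrreducible P V S₂ → IsIrreducible P W (stack S₁ S₂)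
    IsIrreducible-stack {S₁ = S₁} {S₂} irr₁ irr₂ = stack-rep S₁ S₂ (proj₁ irr₁) (proj₁ irr₂) , noStrict
      where
      noStrict : ∀ m′ (S′ : Fin size → Subset m′) → IsInclRep P W S′ →
                 ¬ IsStrictReduction P W S′ (stack S₁ S₂)
      noStrict m′ S′ rep′ (red , ¬back) =
        ¬back (IsReduction-trans (stack-reduction⁺ back₁ back₂) (restack-reduces rep′))
        where
        R′ : Fin size → Subset m′
        R′ = upperPart S′
        repˡ′ : IsInclRep P L S′
        repˡ′ = IsInclRep-⊆ L⊆W rep′
        red′ : IsReduction P W (restack S′) (stack S₁ S₂)
        red′ = IsReduction-trans (restack-reduces rep′) red

        -- Whichever lower part is smaller yields a reduction of S₁ or of S₂, which irreducibility reverses.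
        sameLower : GroundSize P L S′ ≡ GroundSize P L S₁
        sameLower with ≤-total (GroundSize P L S′) (GroundSize P L S₁)
        ... | inj₁ A′≤A₁ = ≤-antisym A′≤A₁
          (proj₁ (IsIrreducible⇒reduction-reverses irr₁ repˡ′ (stack-reduction⁻ˡ red′ A′≤A₁)))
        ... | inj₂ A₁≤A′ = ≤-antisym A′≤A₁ A₁≤A′
          where
          open ≤-Reasoning
          G₂≤G′ : GroundSize P V S₂ ≤ GroundSize P V R′
          G₂≤G′ = proj₁ (IsIrreducible⇒reduction-reverses irr₂ (upperPart-rep rep′) (stack-reduction⁻ʳ red′ A₁≤A′))
          A′≤A₁ : GroundSize P L S′ ≤ GroundSize P L S₁
          A′≤A₁ = +-cancelʳ-≤ (GroundSize P V R′) _ _ (begin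
            GroundSize P L S′ + GroundSize P V R′  ≡⟨ stack-ground S′ R′ ⟨
            GroundSize P W (restack S′)            ≤⟨ proj₁ red′ ⟩
            GroundSize P W (stack S₁ S₂)           ≡⟨ stack-ground S₁ S₂ ⟩
            GroundSize P L S₁ + GroundSize P V S₂  ≤⟨ +-monoʳ-≤ _ G₂≤G′ ⟩
            GroundSize P L S₁ + GroundSize P V R′  ∎)

        back₁ : IsReduction P L S₁ S′
        back₁ = IsIrreducible⇒reduction-reverses irr₁ repˡ′
                  (stack-reduction⁻ˡ red′ (≤-reflexive sameLower))
        back₂ : IsReduction P V S₂ R′
        back₂ = IsIrreducible⇒reduction-reverses irr₂ (upperPart-rep rep′)
                  (stack-reduction⁻ʳ red′ (≤-reflexive (sym sameLower)))

    IsDim2-+ : IsDim2 P L a → IsDim2 P V b → IsDim2 P W (a + b)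
    IsDim2-+ {a} {b} ((_ , S₁ , rep₁ , g₁) , least₁) ((_ , S₂ , rep₂ , g₂) , least₂) =
      (_ , stack S₁ S₂ , stack-rep S₁ S₂ rep₁ rep₂ , trans (stack-ground S₁ S₂) (cong₂ _+_ g₁ g₂)) , least
      where
      least : ∀ m (S : Fin size → Subset m) → IsInclRep P W S → a + b ≤ GroundSize P W S
      least _ S rep = subst (a + b ≤_) (sym (upperPart-ground S))
        (+-mono-≤ (least₁ _ S (IsInclRep-⊆ L⊆W rep)) (least₂ _ (upperPart S) (upperPart-rep rep)))

    IsCh-+ : Nonempty V → IsDim2 P L a → IsCh P V b → IsCh P W (a + b)
    IsCh-+ {a} {b} nonempty ((_ , S₁ , rep₁ , g₁) , least₁) ((_ , S₂ , rep₂ , ht₂) , least₂) =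
      (_ , stack S₁ S₂ , stack-rep S₁ S₂ rep₁ rep₂ , stack-height S₁ S₂ (≤-reflexive g₁) ht₂) , least
      where
      least : ∀ m (S : Fin size → Subset m) h → IsInclRep P W S → HeightAtMost P W S h → a + b ≤ h
      least _ S h rep ht = begin
        a + b                                      ≤⟨ +-mono-≤ (least₁ _ S (IsInclRep-⊆ L⊆W rep))
                                                        (least₂ _ _ _ (upperPart-rep rep) (upperPart-height rep ht)) ⟩
        GroundSize P L S + (h ∸ GroundSize P L S)  ≡⟨ m+[n∸m]≡n (lowerGround≤height rep nonempty ht) ⟩
        h                                          ∎
        where open ≤-Reasoning

    IsCw-+ : Nonempty V → IsDim2 P L a → IsCw P V b → IsCw P W (a + b)
    IsCw-+ {a} {b} nonempty dim₂@((_ , S₁ , rep₁ , g₁) , least₁) (h , ch , (_ , S₂ , rep₂ , ht₂ , g₂) , least₂) =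
      a + h , IsCh-+ nonempty dim₂ ch ,
      (_ , stack S₁ S₂ , stack-rep S₁ S₂ rep₁ rep₂ , stack-height S₁ S₂ (≤-reflexive g₁) ht₂ ,
       trans (stack-ground S₁ S₂) (cong₂ _+_ g₁ g₂)) ,
      least
      where
      least : ∀ m (S : Fin size → Subset m) → IsInclRep P W S → HeightAtMost P W S (a + h) →
              a + b ≤ GroundSize P W S
      least _ S rep ht = subst (a + b ≤_) (sym (upperPart-ground S))
        (+-mono-≤ (≤-reflexive (sym A≡a)) (least₂ _ (upperPart S) (upperPart-rep rep) upperHeight))
        where
        A : ℕ
        A = GroundSize P L S
        a≤A : a ≤ A
        a≤A = least₁ _ S (IsInclRep-⊆ L⊆W rep)
        h≤rest : h ≤ (a + h) ∸ A
        h≤rest = proj₂ ch _ (upperPart S) _ (upperPart-rep rep) (upperPart-height rep ht)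
        A≡a : A ≡ a
        A≡a = ≤-antisym (+-cancelʳ-≤ h A a (begin
          A + h              ≤⟨ +-monoʳ-≤ A h≤rest ⟩
          A + ((a + h) ∸ A)  ≡⟨ m+[n∸m]≡n (lowerGround≤height rep nonempty ht) ⟩
          a + h              ∎)) a≤A
          where open ≤-Reasoning
        upperHeight : HeightAtMost P V (upperPart S) h
        upperHeight = subst (HeightAtMost P V (upperPart S))
          (trans (cong ((a + h) ∸_) A≡a) (m+n∸m≡n a h)) (upperPart-height rep ht)

    IsIir-+ : IsIir P L a → IsIir P V b → IsIir P W (a + b)
    IsIir-+ {a} {b} ((_ , S₁ , irr₁ , g₁) , greatest₁) ((_ , S₂ , irr₂ , g₂) , greatest₂) =
      (_ , stack S₁ S₂ , IsIrreducible-stack irr₁ irr₂ , trans (stack-ground S₁ S₂) (cong₂ _+_ g₁ g₂)) ,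
      λ _ S irr → subst (_≤ a + b) (sym (upperPart-ground S))
        (+-mono-≤ (greatest₁ _ S (IsIrreducible-restrictˡ irr)) (greatest₂ _ _ (IsIrreducible-upperPart irr)))

module Blocks (P : FinPoset) where

  open FinPoset P
  open import Relation.Binary.Structures using (IsPartialOrder)
  open IsPartialOrder isPartialOrder using () renaming (reflexive to ≼-reflexive)
  open SubsetLemmas using (∈-tabulate⁻; ∈-tabulate⁺)
  open VerticalSplits P using (IsGreatest; IsLeast)
  open import Data.Bool.Base using (true; false; _∧_; if_then_else_)
  open import Data.Nat.Base using (s≤s)
  open import Data.Fin.Base using (zero; suc; _<_)
  open import Data.Fin.Properties using (_≟_; any?)
  open import Data.Fin.Subset using (_∈_)
  open import Data.Fin.Subset.Properties using (_∈?_)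
  open import Data.Vec.Base using (lookup)
  open import Data.Vec.Properties using ([]=⇒lookup; lookup⇒[]=)
  open import Data.Product.Base using (∃)
  open import Data.Sum.Base using (_⊎_; inj₁; inj₂)
  open import Data.Empty using (⊥-elim)
  open import Relation.Nullary using (yes; no; does; contradiction; ¬?)
  open import Relation.Nullary.Decidable using (⌊_⌋; _×-dec_; dec-true; dec-false; decidable-stable)
  open import Relation.Unary using (Decidable)
  open import Relation.Binary.PropositionalEquality using (refl; sym; trans; cong; subst)

  ∈-Level⁻ : ∀ {t} U (g : Fin size → Fin t) {i x} → x ∈ Level P U g i → x ∈ U × g x ≡ i
  ∈-Level⁻ U g {i} {x} x∈ with lookup U x in x∈U | g x ≟ i | ∈-tabulate⁻ x∈
  ... | true  | yes gx≡i | _  = lookup⇒[]= x U x∈U , gx≡i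
  ... | true  | no  _    | ()
  ... | false | _        | ()

  ∈-Level⁺ : ∀ {t U} {g : Fin size → Fin t} {i x} → x ∈ U → g x ≡ i → x ∈ Level P U g i
  ∈-Level⁺ {U = U} {g} {i} {x} x∈U gx≡i = ∈-tabulate⁺ lookup∧≟
    where
    lookup∧≟ : lookup U x ∧ ⌊ g x ≟ i ⌋ ≡ true
    lookup∧≟ with g x ≟ i
    ... | yes _    = cong (_∧ true) ([]=⇒lookup x∈U)
    ... | no gx≢i = contradiction gx≡i gx≢i

  subsingleton⇒IsChain : ∀ {U} {x : Fin size} → (∀ z → z ∈ U → z ≡ x) → IsChain P U
  subsingleton⇒IsChain all≡x a b a∈U b∈U = inj₁ (≼-reflexive (trans (all≡x a a∈U) (sym (all≡x b b∈U))))

  subsingleton-or-other : ∀ U (x : Fin size) → (∀ z → z ∈ U → z ≡ x) ⊎ ∃ λ z → z ∈ U × ¬ z ≡ x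
  subsingleton-or-other U x with any? (λ z → (z ∈? U) ×-dec ¬? (z ≟ x))
  ... | yes other = inj₂ other
  ... | no  none  = inj₁ λ z z∈U → decidable-stable (z ≟ x) (λ z≢x → none (z , z∈U , z≢x))

  upperCut⇒IsVerticalSumOfTwo : ∀ {U} {Upper : Fin size → Set} (Upper? : Decidable Upper) →
                          (∃ λ z → z ∈ U × ¬ Upper z) → (∃ λ z → z ∈ U × Upper z) →
                          (∀ {a b} → a ∈ U → b ∈ U → ¬ Upper a → Upper b → a ≼ b) →
                          IsVerticalSumOfTwo P U
  upperCut⇒IsVerticalSumOfTwo {U} Upper? (z₀ , z₀∈U , ¬upper) (z₁ , z₁∈U , upper) lower≼upper =
    side , (onto , ordered)
    where
    side : Fin size → Fin 2
    side x = if does (Upper? x) then suc zero else zero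

    onto : ∀ i → ∃ λ x → x ∈ U × side x ≡ i
    onto zero       = z₀ , z₀∈U , cong (if_then suc zero else zero) (dec-false (Upper? z₀) ¬upper)
    onto (suc zero) = z₁ , z₁∈U , cong (if_then suc zero else zero) (dec-true (Upper? z₁) upper)

    ordered : ∀ a b → a ∈ U → b ∈ U → side a < side b → a ≼ b
    ordered a b a∈U b∈U a<b with Upper? a | Upper? b
    ... | no ¬ua | yes ub = lower≼upper a∈U b∈U ¬ua ub
    ordered a b a∈U b∈U ()          | no _  | no _
    ordered a b a∈U b∈U ()          | yes _ | no _
    ordered a b a∈U b∈U (s≤s ())    | yes _ | yes _

  IsBlock∧IsGreatest⇒IsChain : ∀ {U x} → IsBlock P U → IsGreatest U x → IsChain P U
  IsBlock∧IsGreatest⇒IsChain (inj₁ chain) _ = chain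
  IsBlock∧IsGreatest⇒IsChain {U} {x} (inj₂ notSum) (x∈U , greatest) with subsingleton-or-other U x
  ... | inj₁ all≡x = subsingleton⇒IsChain all≡x
  ... | inj₂ other = ⊥-elim (notSum (upperCut⇒IsVerticalSumOfTwo (_≟ x) other (x , x∈U , refl)
                                       λ {a} a∈U _ _ b≡x → subst (a ≼_) (sym b≡x) (greatest a a∈U)))

  IsBlock∧IsLeast⇒IsChain : ∀ {U y} → IsBlock P U → IsLeast U y → IsChain P U
  IsBlock∧IsLeast⇒IsChain (inj₁ chain) _ = chain
  IsBlock∧IsLeast⇒IsChain {U} {y} (inj₂ notSum) (y∈U , least) with subsingleton-or-other U y
  ... | inj₁ all≡y = subsingleton⇒IsChain all≡y
  ... | inj₂ other = ⊥-elim (notSum (upperCut⇒IsVerticalSumOfTwo (λ z → ¬? (z ≟ y)) (y , y∈U , λ y≢y → y≢y refl) other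
                                       λ {a} {b} _ b∈U ¬a≢y _ →
                                         subst (_≼ b) (sym (decidable-stable (a ≟ y) ¬a≢y)) (least b b∈U)))

module Telescoping where

  open import Data.Nat.Properties using (+-identityʳ; +-assoc)
  open import Data.Fin.Base using (zero; suc; toℕ)
  open import Relation.Binary.PropositionalEquality using (sym; subst)

  -- B i stands for the union of the first i pieces Q 0, …, Q (i - 1).
  telescope : ∀ {a ℓ} {A : Set a} (X : A → ℕ → Set ℓ) {t} (B : ℕ → A) (Q : Fin t → A) {vals : Fin t → ℕ} →
              (∀ i {u v} → X (B (toℕ i)) u → X (Q i) v → X (B (suc (toℕ i))) (u + v)) →
              (∀ i → X (Q i) (vals i)) → ∀ {c} → X (B 0) c → X (B t) (c + sum (tabulate vals))
  telescope X {zero} B Q step pieces {c} base = subst (X (B 0)) (sym (+-identityʳ c)) base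
  telescope X {suc t} B Q {vals} step pieces {c} base =
    subst (X (B (suc t))) (+-assoc c (vals zero) _)
      (telescope X (λ i → B (suc i)) (λ i → Q (suc i)) (λ i → step (suc i)) (λ i → pieces (suc i))
                 (step zero base (pieces zero)))

module PinchLemmas where

  open import Data.Fin.Base using (zero; suc; inject₁; pinch)
  open import Data.Fin.Properties using (suc-injective)
  open import Data.Sum.Base using (_⊎_; inj₁; inj₂; map)
  open import Relation.Binary.PropositionalEquality using (refl; cong)

  pinch-suc : ∀ {k} (c : Fin k) → pinch c (suc c) ≡ c
  pinch-suc zero    = refl
  pinch-suc (suc c) = cong suc (pinch-suc c)

  pinch-fiber : ∀ {k} (c : Fin k) j → pinch c j ≡ c → j ≡ inject₁ c ⊎ j ≡ suc c
  pinch-fiber {suc _} zero zero    _    = inj₁ refl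
  pinch-fiber zero    (suc j)      refl = inj₂ refl
  pinch-fiber (suc c) (suc j)      eq   = map (cong suc) (cong suc) (pinch-fiber c j (suc-injective eq))

module BlockDecomposition (P : FinPoset) {k : ℕ} {f : Fin (FinPoset.size P) → Fin (suc k)}
                          (decomposition : IsBlockDecomposition P (suc k) f) (notBlock : ¬ IsBlock P ⊤) where

  open FinPoset P
  open import Relation.Binary.Structures using (IsPartialOrder)
  open IsPartialOrder isPartialOrder using (antisym)
  open SubsetLemmas using (∈-tabulate⁻; ∈-tabulate⁺)
  open VerticalSplits P using (IsGreatest; IsLeast; IsVerticalSplit)
  open Blocks P
  open Telescoping
  open PinchLemmas
  open import Data.Nat.Base using (_<_; _≤_; z≤n; s≤s; s≤s⁻¹)
  open import Data.Nat.Properties as ℕ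
    using (_<?_; ≤-reflexive; ≤-antisym; <⇒≱; ≰⇒>; ≮⇒≥; n≮0; m<n⇒m<1+n; m≤n⇒m<n∨m≡n)
  open import Data.Fin.Base as Fin using (zero; suc; toℕ; inject₁; pinch; fromℕ<)
  open import Data.Fin.Properties
    using (_≟_; ¬Fin0; toℕ<n; toℕ-injective; toℕ-inject₁; toℕ-fromℕ; ≤̄⇒inject₁<; pinch-surjective;
           pinch-mono-≤; pinch-injective)
  open import Data.Fin.Subset using (Subset; _∈_; Nonempty; Empty)
  open import Data.Fin.Subset.Properties using (∈⊤; ⊆⊤; ⊆-antisym; x∉p⇒x∈∁p; x∈∁p⇒x∉p)
  open import Data.Product.Base using (∃; proj₁; proj₂)
  open import Data.Sum.Base using (_⊎_; inj₁; inj₂)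
  open import Data.Empty using (⊥)
  open import Data.Bool.Base using (true)
  open import Function.Base using (_∘_; case_of_)
  open import Relation.Nullary using (yes; no; contradiction)
  open import Relation.Nullary.Decidable using (⌊_⌋)
  open import Relation.Binary.PropositionalEquality using (refl; sym; trans; cong; subst; subst₂)

  Q : Fin (suc k) → Subset size
  Q = Level P ⊤ f

  private
    onto : ∀ i → ∃ λ x → x ∈ ⊤ × f x ≡ i
    onto = proj₁ (proj₁ (proj₂ (proj₁ decomposition)))

    ordered : ∀ {x y} → f x Fin.< f y → x ≼ y
    ordered = proj₂ (proj₁ (proj₂ (proj₁ decomposition))) _ _ ∈⊤ ∈⊤

    blocks : ∀ i → IsBlock P (Q i)
    blocks = proj₂ (proj₂ (proj₁ decomposition))

    minimal : ∀ t g → IsDecompIntoBlocks P t g → suc k ≤ t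
    minimal = proj₂ decomposition

  ∈-Q⁻ : ∀ {i x} → x ∈ Q i → f x ≡ i
  ∈-Q⁻ = proj₂ ∘ ∈-Level⁻ ⊤ f

  ∈-Q⁺ : ∀ {i x} → f x ≡ i → x ∈ Q i
  ∈-Q⁺ = ∈-Level⁺ ∈⊤

  Q-nonempty : ∀ i → Nonempty (Q i)
  Q-nonempty i with onto i
  ... | x , _ , fx≡i = x , ∈-Q⁺ fx≡i

  level-mono : ∀ {x y} → x ≼ y → f x Fin.≤ f y
  level-mono x≼y = ≮⇒≥ λ fy<fx → ℕ.<-irrefl (cong (toℕ ∘ f) (antisym (ordered fy<fx) x≼y)) fy<fx

  Level-Fin1 : (g : Fin size → Fin 1) → Level P ⊤ g zero ≡ ⊤
  Level-Fin1 g = ⊆-antisym ⊆⊤ λ {x} _ → ∈-Level⁺ ∈⊤ (Fin1≡zero (g x))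
    where
    Fin1≡zero : (i : Fin 1) → i ≡ zero
    Fin1≡zero zero = refl

  -- Minimality only excludes decompositions into two or more blocks; a one-block
  -- decomposition would make P itself a block.
  noShorterDecomposition : ∀ {t} (g : Fin size → Fin t) → t < suc k → IsVerticalDecomp P ⊤ t g →
                           (∀ i → IsBlock P (Level P ⊤ g i)) → ⊥
  noShorterDecomposition {zero}        g _   _      _       = ¬Fin0 (g (fromℕ< nonEmpty))
  noShorterDecomposition {suc zero}    g _   _      gBlocks = notBlock (subst (IsBlock P) (Level-Fin1 g) (gBlocks zero))
  noShorterDecomposition {suc (suc _)} g t<k gDecomp gBlocks =
    <⇒≱ t<k (minimal _ g (s≤s (s≤s z≤n) , gDecomp , gBlocks))

  -- pinch c merges the adjacent levels inject₁ c and suc c; two adjacent chains merge into one chain.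
  adjacentChains⇒⊥ : (c : Fin k) → IsChain P (Q (inject₁ c)) → IsChain P (Q (suc c)) → ⊥
  adjacentChains⇒⊥ c chain₁ chain₂ =
    noShorterDecomposition merged (ℕ.n<1+n k) (mergedOnto , mergedOrdered) mergedBlocks
    where
    merged : Fin size → Fin k
    merged x = pinch c (f x)

    mergedOnto : ∀ d → ∃ λ x → x ∈ ⊤ × merged x ≡ d
    mergedOnto d with pinch-surjective c d
    ... | j , pinch≡d with onto j
    ...   | x , _ , fx≡j = x , ∈⊤ , pinch≡d fx≡j

    mergedOrdered : ∀ x y → x ∈ ⊤ → y ∈ ⊤ → merged x Fin.< merged y → x ≼ y
    mergedOrdered x y _ _ lt = ordered (≰⇒> λ fy≤fx → <⇒≱ lt (pinch-mono-≤ c fy≤fx))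

    inTwoLevels : ∀ {x} → x ∈ Level P ⊤ merged c → x ∈ Q (inject₁ c) ⊎ x ∈ Q (suc c)
    inTwoLevels x∈ with pinch-fiber c _ (proj₂ (∈-Level⁻ ⊤ merged x∈))
    ... | inj₁ fx≡c  = inj₁ (∈-Q⁺ fx≡c)
    ... | inj₂ fx≡c+1 = inj₂ (∈-Q⁺ fx≡c+1)

    c<c+1 : inject₁ c Fin.< suc c
    c<c+1 = ≤̄⇒inject₁< ℕ.≤-refl

    mergedChain : IsChain P (Level P ⊤ merged c)
    mergedChain x y x∈ y∈ with inTwoLevels x∈ | inTwoLevels y∈
    ... | inj₁ x∈₁ | inj₁ y∈₁ = chain₁ x y x∈₁ y∈₁
    ... | inj₂ x∈₂ | inj₂ y∈₂ = chain₂ x y x∈₂ y∈₂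
    ... | inj₁ x∈₁ | inj₂ y∈₂ = inj₁ (ordered (subst₂ Fin._<_ (sym (∈-Q⁻ x∈₁)) (sym (∈-Q⁻ y∈₂)) c<c+1))
    ... | inj₂ x∈₂ | inj₁ y∈₁ = inj₂ (ordered (subst₂ Fin._<_ (sym (∈-Q⁻ y∈₁)) (sym (∈-Q⁻ x∈₂)) c<c+1))

    mergedBlocks : ∀ d → IsBlock P (Level P ⊤ merged d)
    mergedBlocks d with d ≟ c
    ... | yes refl = inj₁ mergedChain
    ... | no  d≢c with pinch-surjective c d
    ...   | j , pinch≡d = subst (IsBlock P) (⊆-antisym (λ x∈ → ∈-Level⁺ ∈⊤ (pinch≡d (∈-Q⁻ x∈))) ⊆Qj) (blocks j)
      where
      notSuc : ∀ {j′} → pinch c j′ ≡ d → ¬ suc c ≡ j′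
      notSuc pinch≡d′ refl = d≢c (trans (sym pinch≡d′) (pinch-suc c))
      ⊆Qj : ∀ {x} → x ∈ Level P ⊤ merged d → x ∈ Q j
      ⊆Qj x∈ = ∈-Q⁺ (pinch-injective (notSuc mx≡d) (notSuc (pinch≡d refl)) (trans mx≡d (sym (pinch≡d refl))))
        where
        mx≡d : merged _ ≡ d
        mx≡d = proj₂ (∈-Level⁻ ⊤ merged x∈)

  Below : ℕ → Subset size
  Below m = tabulate (λ x → ⌊ toℕ (f x) <? m ⌋)

  ∈-Below⁻ : ∀ {m x} → x ∈ Below m → toℕ (f x) < m
  ∈-Below⁻ {m} {x} x∈ with toℕ (f x) <? m | ∈-tabulate⁻ {x = x} x∈
  ... | yes lt | _ = lt

  ∈-Below⁺ : ∀ {m x} → toℕ (f x) < m → x ∈ Below m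
  ∈-Below⁺ {m} {x} lt = ∈-tabulate⁺ isYes
    where
    isYes : ⌊ toℕ (f x) <? m ⌋ ≡ true
    isYes with toℕ (f x) <? m
    ... | yes _  = refl
    ... | no  ≮m = contradiction lt ≮m

  Below-empty : Empty (Below 0)
  Below-empty (_ , x∈) = n≮0 (∈-Below⁻ x∈)

  Below-all : Below (suc k) ≡ ⊤
  Below-all = ⊆-antisym ⊆⊤ λ {x} _ → ∈-Below⁺ (toℕ<n (f x))

  Below-last : Below k ≡ ∁ (Q (Fin.fromℕ k))
  Below-last = ⊆-antisym
    (λ x∈ → x∉p⇒x∈∁p λ x∈Q → ℕ.<-irrefl (trans (cong toℕ (∈-Q⁻ x∈Q)) (toℕ-fromℕ k)) (∈-Below⁻ x∈))
    (λ {x} x∈∁ → case m≤n⇒m<n∨m≡n (s≤s⁻¹ (toℕ<n (f x))) of λ where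
       (inj₁ fx<k) → ∈-Below⁺ fx<k
       (inj₂ fx≡k) → contradiction (∈-Q⁺ (toℕ-injective (trans fx≡k (sym (toℕ-fromℕ k))))) (x∈∁p⇒x∉p x∈∁))

  private
    Q-inject₁⊆Below : ∀ c {x} → x ∈ Q (inject₁ c) → x ∈ Below (toℕ (suc c))
    Q-inject₁⊆Below c x∈ = ∈-Below⁺ (s≤s (≤-reflexive (trans (cong toℕ (∈-Q⁻ x∈)) (toℕ-inject₁ c))))

  greatestBelow⇒greatestOfLevel : ∀ c {x} → IsGreatest (Below (toℕ (suc c))) x → IsGreatest (Q (inject₁ c)) x
  greatestBelow⇒greatestOfLevel c {x} (x∈ , greatest) =
    ∈-Q⁺ (toℕ-injective (≤-antisym fx≤c c≤fx)) , λ z z∈ → greatest z (Q-inject₁⊆Below c z∈)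
    where
    fx≤c : toℕ (f x) ≤ toℕ (inject₁ c)
    fx≤c = subst (toℕ (f x) ≤_) (sym (toℕ-inject₁ c)) (s≤s⁻¹ (∈-Below⁻ x∈))
    c≤fx : toℕ (inject₁ c) ≤ toℕ (f x)
    c≤fx with onto (inject₁ c)
    ... | z , _ , fz≡c = subst (λ i → toℕ i ≤ toℕ (f x)) fz≡c
                            (level-mono (greatest z (Q-inject₁⊆Below c (∈-Q⁺ fz≡c))))

  noJunctionBelow : ∀ i {x y} → IsGreatest (Below (toℕ i)) x → IsLeast (Q i) y → ⊥
  noJunctionBelow zero    (x∈ , _) _     = n≮0 (∈-Below⁻ x∈)
  noJunctionBelow (suc c) greatest least =
    adjacentChains⇒⊥ c (IsBlock∧IsGreatest⇒IsChain (blocks _) (greatestBelow⇒greatestOfLevel c greatest))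
                       (IsBlock∧IsLeast⇒IsChain (blocks _) least)

  Below-split : ∀ i → IsVerticalSplit (Below (suc (toℕ i))) (Below (toℕ i)) (Q i)
  Below-split i = record
    { disjoint   = λ x∈ x∈Q → ℕ.<-irrefl (cong toℕ (∈-Q⁻ x∈Q)) (∈-Below⁻ x∈)
    ; cover      = λ {x} x∈ → case m≤n⇒m<n∨m≡n (s≤s⁻¹ (∈-Below⁻ x∈)) of λ where
                     (inj₁ fx<i) → inj₁ (∈-Below⁺ fx<i)
                     (inj₂ fx≡i) → inj₂ (∈-Q⁺ (toℕ-injective fx≡i))
    ; L⊆W        = λ x∈ → ∈-Below⁺ (m<n⇒m<1+n (∈-Below⁻ x∈))
    ; V⊆W        = λ x∈Q → ∈-Below⁺ (s≤s (≤-reflexive (cong toℕ (∈-Q⁻ x∈Q))))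
    ; below      = λ x∈ y∈Q → ordered (subst (toℕ (f _) <_) (sym (cong toℕ (∈-Q⁻ y∈Q))) (∈-Below⁻ x∈))
    ; noJunction = noJunctionBelow i
    }

  top-split : IsVerticalSplit ⊤ (∁ (Q (Fin.fromℕ k))) (Q (Fin.fromℕ k))
  top-split = subst₂ (λ W L → IsVerticalSplit W L (Q (Fin.fromℕ k)))
    (trans (cong (Below ∘ suc) (toℕ-fromℕ k)) Below-all) (trans (cong Below (toℕ-fromℕ k)) Below-last)
    (Below-split (Fin.fromℕ k))

  sumOverBlocks : (X : Subset size → ℕ → Set) → (∀ {U} → Empty U → X U 0) →
                  (∀ {W L V} → IsVerticalSplit W L V → ∀ {a b} → X L a → X V b → X W (a + b)) →
                  ∀ {vals} → (∀ i → X (Q i) (vals i)) → X ⊤ (sum (tabulate vals))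
  sumOverBlocks X empty additive pieces =
    subst (λ U → X U _) Below-all
      (telescope X Below Q (λ i → additive (Below-split i)) pieces (empty Below-empty))

open Representations using (IsDim2-empty; IsIir-empty; IsDim2-unique; IsCh-unique; IsCw-unique; IsIir-unique)
open VerticalSplits using (IsDim2-+; IsCh-+; IsCw-+; IsIir-+)

proposition3p3 : (P : FinPoset) → ¬ IsBlock P ⊤ →
    (k : ℕ) (f : Fin (FinPoset.size P) → Fin (suc k)) →
    IsBlockDecomposition P (suc k) f →
    ((c a b : ℕ) → IsCh P ⊤ c → IsDim2 P (∁ (Level P ⊤ f (fromℕ k))) a →
       IsCh P (Level P ⊤ f (fromℕ k)) b → c ≡ a + b)
    × ((d : ℕ) (ds : Fin (suc k) → ℕ) → IsDim2 P ⊤ d →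
       (∀ i → IsDim2 P (Level P ⊤ f i) (ds i)) → d ≡ sum (tabulate ds))
    × ((w a b : ℕ) → IsCw P ⊤ w → IsDim2 P (∁ (Level P ⊤ f (fromℕ k))) a →
       IsCw P (Level P ⊤ f (fromℕ k)) b → w ≡ a + b)
    × ((r : ℕ) (rs : Fin (suc k) → ℕ) → IsIir P ⊤ r →
       (∀ i → IsIir P (Level P ⊤ f i) (rs i)) → r ≡ sum (tabulate rs))
proposition3p3 P notBlock k f decomposition =
  (λ _ _ _ ch dim₂ chTop → IsCh-unique P ch (IsCh-+ P top-split (Q-nonempty _) dim₂ chTop)) ,
  (λ _ _ dim₂ dim₂s → IsDim2-unique P dim₂ (sumOverBlocks (IsDim2 P) (IsDim2-empty P) (IsDim2-+ P) dim₂s)) ,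
  (λ _ _ _ cw dim₂ cwTop → IsCw-unique P cw (IsCw-+ P top-split (Q-nonempty _) dim₂ cwTop)) ,
  (λ _ _ iir iirs → IsIir-unique P iir (sumOverBlocks (IsIir P) (IsIir-empty P) (IsIir-+ P) iirs))
  where open BlockDecomposition P decomposition notBlock
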